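{- Suppose that every bipartite dHp graph $G$ with sides $A$ and $B$, both infinite, in which every vertex of $A$ has finite degree and in which for each $v\in B$ either $N(v)$ is finite or $N(v)=A\setminus F_v$ for some finite $F_v\subset A$, admits a double ray $A$-cover. Then every finite bipartite dHp graph $M$ with sides $X$ and $Y$ contains a path covering all the vertices of $X$.
   Context: For $X\subseteq V(G)$ with $|X|\ge 2$, $N^2(X)$ denotes the set of vertices of $G$ having at least two neighbours in $X$. A bipartite graph $G$ with sides $A$ and $B$ is a dHp graph if $|A|\ge 2$ and $|N^2(X)|\ge |X|$ for every $X\subseteq A$ with $|X|\ge 2$. A double ray is a two-way infinite path. A double ray $A$-cover of $G$ is a family of pairwise vertex-disjoint double rays in $G$ such that every vertex of $A$ lies on one of them. A path covering $X$ is a path $P$ in $M$ with $X\subseteq V(P)$. -}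

module Defs where

open import Data.Nat using (ℕ; suc)
open import Data.Integer using (ℤ) renaming (suc to sucℤ)
open import Data.Fin using (Fin; inject₁) renaming (suc to fsuc)
open import Data.Bool using (Bool; T; not)
open import Data.Sum using (_⊎_; inj₁; inj₂)
open import Data.Product using (Σ; Σ-syntax; ∃; ∃-syntax; _×_; proj₁)
open import Data.Empty using (⊥)
open import Relation.Nullary using (¬_)
open import Relation.Binary.PropositionalEquality using (_≡_; _≢_)
open import Function.Bundles using (_↔_; _⇔_)

Finite : Set → Set
Finite S = Σ[ n ∈ ℕ ] (S ↔ Fin n)

Infinite : Set → Set
Infinite S = ¬ Finite S

record BipGraph : Set₁ where
  field
    A : Set
    B : Set
    E : A → B → Bool

module _ (G : BipGraph) where
  open BipGraph G

  V : Set
  V = A ⊎ B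

  Adj : V → V → Set
  Adj (inj₁ a) (inj₂ b) = T (E a b)
  Adj (inj₂ b) (inj₁ a) = T (E a b)
  Adj (inj₁ _) (inj₁ _) = ⊥
  Adj (inj₂ _) (inj₂ _) = ⊥

  Elems : (A → Bool) → Set
  Elems X = Σ[ a ∈ A ] T (X a)

  AtLeastTwo : (A → Bool) → Set
  AtLeastTwo X = ∃[ x ] ∃[ y ] (x ≢ y × T (X x) × T (X y))

  InN² : (A → Bool) → B → Set
  InN² X b = ∃[ x ] ∃[ y ] (x ≢ y × T (X x) × T (X y) × T (E x b) × T (E y b))

  -- |N²(X)| ≥ |X| : there is an injection from X into N²(X)
  N²Large : (A → Bool) → Set
  N²Large X = Σ[ f ∈ (Elems X → B) ]
                ((∀ x → InN² X (f x)) × (∀ x y → f x ≡ f y → proj₁ x ≡ proj₁ y))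

  dHp : Set
  dHp = (Σ[ a₁ ∈ A ] Σ[ a₂ ∈ A ] a₁ ≢ a₂)
      × (∀ (X : A → Bool) → AtLeastTwo X → N²Large X)

  NbA : A → Set
  NbA a = Σ[ b ∈ B ] T (E a b)

  NbB : B → Set
  NbB b = Σ[ a ∈ A ] T (E a b)

  FiniteOrCofiniteNb : B → Set
  FiniteOrCofiniteNb v =
    Finite (NbB v) ⊎
    (Σ[ F ∈ (A → Bool) ] (Finite (Elems F) × (∀ a → T (E a v) ⇔ T (not (F a)))))

  record DoubleRay : Set where
    field
      ray      : ℤ → V
      injective : ∀ i j → ray i ≡ ray j → i ≡ j
      adjacent  : ∀ i → Adj (ray i) (ray (sucℤ i))

  DoubleRayACover : Set₁
  DoubleRayACover =
    Σ[ I ∈ Set ] Σ[ R ∈ (I → DoubleRay) ]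
      ((∀ i j k l → DoubleRay.ray (R i) k ≡ DoubleRay.ray (R j) l → i ≡ j)
      × (∀ a → ∃[ i ] ∃[ k ] (DoubleRay.ray (R i) k ≡ inj₁ a)))

  record Path : Set where
    field
      len       : ℕ
      vtx       : Fin (suc len) → V
      injective : ∀ i j → vtx i ≡ vtx j → i ≡ j
      adjacent  : ∀ (i : Fin len) → Adj (vtx (inject₁ i)) (vtx (fsuc i))

  CoversA : Path → Set
  CoversA P = ∀ a → ∃[ i ] (Path.vtx P i ≡ inj₁ a)

finGraph : (n m : ℕ) → (Fin n → Fin m → Bool) → BipGraph
finGraph n m E = record { A = Fin n ; B = Fin m ; E = E }

{-# OPTIONS --safe #-}

-- Enlarge M to an infinite graph G satisfying the hypothesis: add two B-vertices (gates)
-- joined to all of A, and a ladder, i.e. a half graph on new vertices i ∈ ℕ of A and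
-- j ∈ ℕ of B with i ~ j iff j ≤ i, so that A-degrees stay finite and the new B-vertices
-- have cofinite neighbourhoods. G is dHp: for Z ⊆ A, Z ∩ M is matched into N²(Z) as in M
-- (or to a gate if it is a single vertex), and Z ∩ ℕ by the rank of its elements in Z.
-- In a double ray A-cover of G the only neighbours of M outside M are the gates, so a ray
-- meets M in finite maximal runs with a gate at each end. The run through one vertex of X
-- thus uses both gates, and every other vertex of X, lying on such a run too, lies on it;
-- this run is the required path of M.
module Submission where

open import Defs
open import Data.Nat as ℕ using (ℕ; zero; suc; _≤_; _<_; z≤n; s≤s; _<ᵇ_)
import Data.Nat.Properties as ℕ
open import Data.Integer as ℤ using (ℤ; +_; _+_; _-_; 1ℤ)
import Data.Integer.Properties as ℤ
open import Data.Integer.Tactic.RingSolver using (solve-∀)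
open import Data.Fin using (Fin; zero; suc; toℕ; fromℕ; fromℕ<; inject₁)
open import Data.Fin.Properties as Fin
  using (+↔⊎; 0↔⊥; 1↔⊤; 2↔Bool; pigeonhole; toℕ-injective; toℕ-fromℕ; toℕ-fromℕ<; toℕ-inject; toℕ-inject₁; toℕ<n; ¬∀⟶∃¬-smallest)
open import Data.Bool using (Bool; true; false; T; not; if_then_else_; _≟_)
open import Data.Bool.Properties using (T?; T-irrelevant; ¬-not)
open import Data.Sum as Sum using (_⊎_; inj₁; inj₂; [_,_])
open import Data.Sum.Properties using (inj₁-injective; inj₂-injective)
open import Data.Sum.Function.Propositional using (_⊎-↔_)
open import Data.Product using (Σ; Σ-syntax; ∃; ∃₂; _×_; _,_; proj₁; proj₂)
open import Data.Product.Properties using (Σ-≡,≡→≡)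
open import Data.Product.Function.Dependent.Propositional using (Σ-↔)
open import Data.Unit using (tt)
open import Algebra.Properties.AbelianGroup ℤ.+-0-abelianGroup using (∙-cancelˡ)
open import Relation.Binary.Definitions using (tri<; tri≈; tri>)
open import Function using (_∘_; id)
open import Function.Bundles using (_↔_; mk↔ₛ′; mk⇔; Inverse; Injection)
open import Function.Definitions using (Injective)
open import Function.Properties.Inverse using (↔-refl; ↔-sym; ↔-trans; ↔⇒↣)
open import Function.Related.TypeIsomorphisms using (Σ-distribʳ-⊎)
open import Relation.Nullary using (¬_; Dec; yes; no; contradiction; ¬?; _×-dec_)
open import Relation.Unary using (Decidable)
open import Relation.Binary.PropositionalEquality
  using (_≡_; _≢_; refl; sym; trans; cong; subst; subst₂; module ≡-Reasoning)
open ≡-Reasoning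

private
  variable
    S U : Set
    k : ℕ

-- Finite types

Finite-↔ : S ↔ U → Finite U → Finite S
Finite-↔ S↔U (n , U↔n) = n , ↔-trans S↔U U↔n

Finite-Fin : Finite (Fin k)
Finite-Fin {k} = k , ↔-refl

Finite-⊎ : Finite S → Finite U → Finite (S ⊎ U)
Finite-⊎ (n , S↔n) (m , U↔m) = n ℕ.+ m , ↔-trans (S↔n ⊎-↔ U↔m) (↔-sym +↔⊎)

Finite-T : ∀ b → Finite (T b)
Finite-T false = 0 , ↔-sym 0↔⊥
Finite-T true  = 1 , ↔-sym 1↔⊤

Finite-Bool : Finite Bool
Finite-Bool = 2 , ↔-sym 2↔Bool

Σ-Fin-suc↔ : {Q : Fin (suc k) → Set} → Σ (Fin (suc k)) Q ↔ (Q zero ⊎ Σ (Fin k) (Q ∘ suc))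
Σ-Fin-suc↔ {Q = Q} = mk↔ₛ′ to from to∘from from∘to
  where
  to : Σ _ Q → Q zero ⊎ Σ _ (Q ∘ suc)
  to (zero  , q) = inj₁ q
  to (suc i , q) = inj₂ (i , q)
  from : Q zero ⊎ Σ _ (Q ∘ suc) → Σ _ Q
  from (inj₁ q)       = zero , q
  from (inj₂ (i , q)) = suc i , q
  to∘from : ∀ x → to (from x) ≡ x
  to∘from (inj₁ _) = refl
  to∘from (inj₂ _) = refl
  from∘to : ∀ x → from (to x) ≡ x
  from∘to (zero  , _) = refl
  from∘to (suc _ , _) = refl

Finite-ΣFin : {Q : Fin k → Set} → (∀ i → Finite (Q i)) → Finite (Σ (Fin k) Q)
Finite-ΣFin {zero}  _   = 0 , mk↔ₛ′ (λ { (() , _) }) (λ ()) (λ ()) (λ { (() , _) })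
Finite-ΣFin {suc k} fin = Finite-↔ Σ-Fin-suc↔ (Finite-⊎ (fin zero) (Finite-ΣFin (fin ∘ suc)))

Finite-Σ : {Q : S → Set} → Finite S → (∀ s → Finite (Q s)) → Finite (Σ S Q)
Finite-Σ {Q = Q} (n , e) fin = Finite-↔ (Σ-↔ e Q↔) (Finite-ΣFin (fin ∘ Inverse.from e))
  where
  Q↔ : ∀ {s} → Q s ↔ Q (Inverse.from e (Inverse.to e s))
  Q↔ {s} = subst (λ s′ → Q s ↔ Q s′) (sym (Inverse.strictlyInverseʳ e s)) ↔-refl

Finite-Σℕ-bounded : (P : ℕ → Bool) → (∀ {i} → T (P i) → i < k) → Finite (Σ ℕ (T ∘ P))
Finite-Σℕ-bounded {k} P bound =
  Finite-↔ (mk↔ₛ′ to from to∘from from∘to) (Finite-Σ Finite-Fin (Finite-T ∘ P ∘ toℕ))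
  where
  to : Σ ℕ (T ∘ P) → Σ (Fin k) (T ∘ P ∘ toℕ)
  to (i , p) = fromℕ< (bound p) , subst (T ∘ P) (sym (toℕ-fromℕ< _)) p
  from : Σ (Fin k) (T ∘ P ∘ toℕ) → Σ ℕ (T ∘ P)
  from (i , p) = toℕ i , p
  to∘from : ∀ x → to (from x) ≡ x
  to∘from (i , p) = Σ-≡,≡→≡ (toℕ-injective (toℕ-fromℕ< _) , T-irrelevant _ _)
  from∘to : ∀ x → from (to x) ≡ x
  from∘to (i , p) = Σ-≡,≡→≡ (toℕ-fromℕ< _ , T-irrelevant _ _)

Finite-Σ⊎ℕ-bounded : Finite S → (P : S ⊎ ℕ → Bool) → (∀ {i} → T (P (inj₂ i)) → i < k) →
             Finite (Σ (S ⊎ ℕ) (T ∘ P))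
Finite-Σ⊎ℕ-bounded finS P bound =
  Finite-↔ Σ-distribʳ-⊎ (Finite-⊎ (Finite-Σ finS (Finite-T ∘ P ∘ inj₁)) (Finite-Σℕ-bounded (P ∘ inj₂) bound))

Finite-pigeonhole : (fin : Finite S) (f : Fin (suc (proj₁ fin)) → S) → ¬ Injective _≡_ _≡_ f
Finite-pigeonhole (n , e) f f-inj with pigeonhole (ℕ.n<1+n n) (Inverse.to e ∘ f)
... | i , j , i<j , eq = Fin.<-irrefl (f-inj (Injection.injective (↔⇒↣ e) eq)) i<j

ℕ↣⇒Infinite : (f : ℕ → S) → Injective _≡_ _≡_ f → Infinite S
ℕ↣⇒Infinite f f-inj fin = Finite-pigeonhole fin (f ∘ toℕ) (toℕ-injective ∘ f-inj)

count : (ℕ → Bool) → ℕ → ℕ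
count P zero    = zero
count P (suc i) = if P i then suc (count P i) else count P i

module _ (P : ℕ → Bool) where

  count-≤ : ∀ i → count P i ≤ i
  count-≤ zero = z≤n
  count-≤ (suc i) with P i
  ... | true  = s≤s (count-≤ i)
  ... | false = ℕ.m≤n⇒m≤1+n (count-≤ i)

  count-≤-suc : ∀ i → count P i ≤ count P (suc i)
  count-≤-suc i with P i
  ... | true  = ℕ.n≤1+n _
  ... | false = ℕ.≤-refl

  count-<-suc : ∀ {i} → T (P i) → count P i < count P (suc i)
  count-<-suc {i} Pi with P i
  ... | true = ℕ.n<1+n _

  count-< : ∀ {i j} → i < j → T (P i) → count P i < count P j
  count-< {i} {suc j} (s≤s i≤j) Pi with ℕ.m≤n⇒m<n∨m≡n i≤j
  ... | inj₁ i<j  = ℕ.<-≤-trans (count-< i<j Pi) (count-≤-suc j)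
  ... | inj₂ refl = count-<-suc Pi

  count-injective : ∀ {i j} → T (P i) → T (P j) → count P i ≡ count P j → i ≡ j
  count-injective {i} {j} Pi Pj eq with ℕ.<-cmp i j
  ... | tri< i<j _ _ = contradiction eq (ℕ.<⇒≢ (count-< i<j Pi))
  ... | tri≈ _ i≡j _ = i≡j
  ... | tri> _ _ j<i = contradiction (sym eq) (ℕ.<⇒≢ (count-< j<i Pj))

  count≡suc⇒∃ : ∀ {i r} → count P i ≡ suc r → ∃ λ p → p < i × T (P p) × count P p ≡ r
  count≡suc⇒∃ {suc i} eq with P i in Pi≡
  ... | true  = i , ℕ.n<1+n i , subst T (sym Pi≡) tt , ℕ.suc-injective eq
  ... | false = let p , p<i , Pp , c = count≡suc⇒∃ eq in p , ℕ.m<n⇒m<1+n p<i , Pp , c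

split-offset : ∀ a b {t} → t ≤ a ℕ.+ b →
               (∃ λ c → c < suc a × suc t ℕ.+ c ≡ suc a) ⊎ (∃ λ c → c < suc b × suc a ℕ.+ c ≡ suc t)
split-offset a b {t} t≤a+b with t ℕ.≤? a
... | yes t≤a =
  let c , t+c≡a = ℕ.m≤n⇒∃[o]m+o≡n t≤a
  in inj₁ (c , s≤s (subst (c ≤_) t+c≡a (ℕ.m≤n+m c t)) , cong suc t+c≡a)
... | no t≰a =
  let c , 1+a+c≡t = ℕ.m≤n⇒∃[o]m+o≡n (ℕ.≰⇒> t≰a)
      a+c<a+b = subst (_≤ a ℕ.+ b) (sym 1+a+c≡t) t≤a+b
  in inj₂ (suc c , s≤s (ℕ.+-cancelˡ-< a c b a+c<a+b) , trans (cong suc (ℕ.+-suc a c)) (cong suc 1+a+c≡t))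

i-m+m≡i : ∀ i m → i - + m + + m ≡ i
i-m+m≡i i m = lemma i (+ m)
  where
  lemma : ∀ i x → i - x + x ≡ i
  lemma = solve-∀

i-m+n≡i-o : ∀ i {m n o} → n ℕ.+ o ≡ m → i - + m + + n ≡ i - + o
i-m+n≡i-o i {n = n} {o} refl = begin
  i - + (n ℕ.+ o) + + n ≡⟨ cong (λ x → i - x + + n) (ℤ.pos-+ n o) ⟩
  i - (+ n + + o) + + n ≡⟨ lemma i (+ n) (+ o) ⟩
  i - + o               ∎
  where
  lemma : ∀ i x y → i - (x + y) + x ≡ i - y
  lemma = solve-∀

i-m+n≡i+o : ∀ i {m n o} → m ℕ.+ o ≡ n → i - + m + + n ≡ i + + o
i-m+n≡i+o i {m} {o = o} refl = begin
  i - + m + + (m ℕ.+ o) ≡⟨ cong (λ x → i - + m + x) (ℤ.pos-+ m o) ⟩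
  i - + m + (+ m + + o) ≡⟨ lemma i (+ m) (+ o) ⟩
  i + + o               ∎
  where
  lemma : ∀ i x y → i - x + (x + y) ≡ i + y
  lemma = solve-∀

suc[i+n]≡i+[1+n] : ∀ i n → ℤ.suc (i + + n) ≡ i + + suc n
suc[i+n]≡i+[1+n] i n = lemma i (+ n)
  where
  lemma : ∀ i x → 1ℤ + (i + x) ≡ i + (1ℤ + x)
  lemma = solve-∀

i+m≡i+n⇒m≡n : ∀ i {m n} → i + + m ≡ i + + n → m ≡ n
i+m≡i+n⇒m≡n i = ℤ.+-injective ∘ ∙-cancelˡ i _ _

i-m≡i-n⇒m≡n : ∀ i {m n} → i - + m ≡ i - + n → m ≡ n
i-m≡i-n⇒m≡n i = ℤ.+-injective ∘ ℤ.neg-injective ∘ ∙-cancelˡ i _ _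

i+[1+n]≢i : ∀ i n → i + + suc n ≢ i
i+[1+n]≢i i n eq with i+m≡i+n⇒m≡n i (trans eq (sym (ℤ.+-identityʳ i)))
... | ()

ends-unique : ∀ {lo lo′ len len′} →
  lo′ ≡ lo ⊎ lo′ ≡ lo + + suc (suc len) →
  lo′ + + suc (suc len′) ≡ lo ⊎ lo′ + + suc (suc len′) ≡ lo + + suc (suc len) →
  lo′ ≡ lo × len′ ≡ len
ends-unique {lo} (inj₁ refl) (inj₁ eq) = contradiction eq (i+[1+n]≢i lo _)
ends-unique {lo} (inj₁ refl) (inj₂ eq) = refl , ℕ.suc-injective (ℕ.suc-injective (i+m≡i+n⇒m≡n lo eq))
ends-unique {lo} {len = len} {len′} (inj₂ refl) (inj₁ eq) = contradiction wraps (i+[1+n]≢i lo _)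
  where
  wraps : lo + + (suc (suc len) ℕ.+ suc (suc len′)) ≡ lo
  wraps = trans (trans (cong (λ x → lo + x) (ℤ.pos-+ (suc (suc len)) _)) (sym (ℤ.+-assoc lo _ _))) eq
ends-unique (inj₂ refl) (inj₂ eq) = contradiction eq (i+[1+n]≢i _ _)

-- Maximal runs of a predicate along an injective ℤ-sequence

record MaximalRun (Q : S → Set) (r : ℤ → S) (lo : ℤ) (len : ℕ) : Set where
  field
    before : ¬ Q (r lo)
    after  : ¬ Q (r (lo + + suc (suc len)))
    inside : (t : Fin (suc len)) → Q (r (lo + + suc (toℕ t)))

module _ {Q : S → Set} (Q? : Decidable Q) (finite : Finite (Σ S Q)) where

  first-exit : (f : ℕ → S) → Injective _≡_ _≡_ f → ∃ λ d → ¬ Q (f d) × (∀ {e} → e < d → Q (f e))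
  first-exit f f-inj =
    let d , ¬Qd , below = ¬∀⟶∃¬-smallest _ (Q ∘ f ∘ toℕ) (Q? ∘ f ∘ toℕ) not-all
    in toℕ d , ¬Qd , λ e<d → subst (Q ∘ f) (trans (toℕ-inject _) (toℕ-fromℕ< e<d)) (below (fromℕ< e<d))
    where
    not-all : ¬ (∀ i → Q (f (toℕ i)))
    not-all all = Finite-pigeonhole finite (λ i → f (toℕ i) , all i) (toℕ-injective ∘ f-inj ∘ cong proj₁)

  maximalRun-around : (r : ℤ → S) → Injective _≡_ _≡_ r → ∀ {k} → Q (r k) →
                      ∃₂ λ lo len → MaximalRun Q r lo len × Σ[ t ∈ Fin (suc len) ] k ≡ lo + + suc (toℕ t)
  maximalRun-around r r-inj {k} Qk
    with first-exit (λ e → r (k - + e)) (i-m≡i-n⇒m≡n k ∘ r-inj)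
       | first-exit (λ e → r (k + + e)) (i+m≡i+n⇒m≡n k ∘ r-inj)
  ... | zero , ¬Qk , _ | _ = contradiction (subst (Q ∘ r) (sym (ℤ.+-identityʳ k)) Qk) ¬Qk
  ... | _ | zero , ¬Qk , _ = contradiction (subst (Q ∘ r) (sym (ℤ.+-identityʳ k)) Qk) ¬Qk
  ... | suc a , ¬Q-lo , Q-backward | suc b , ¬Q-hi , Q-forward =
    lo , a ℕ.+ b , run , fromℕ< (s≤s (ℕ.m≤m+n a b)) , k-position
    where
    lo : ℤ
    lo = k - + suc a

    inside : (t : Fin (suc (a ℕ.+ b))) → Q (r (lo + + suc (toℕ t)))
    inside t with split-offset a b (ℕ.≤-pred (toℕ<n t))
    ... | inj₁ (c , c<1+a , t+c≡a) = subst (Q ∘ r) (sym (i-m+n≡i-o k t+c≡a)) (Q-backward c<1+a)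
    ... | inj₂ (c , c<1+b , a+c≡t) = subst (Q ∘ r) (sym (i-m+n≡i+o k a+c≡t)) (Q-forward c<1+b)

    run : MaximalRun Q r lo (a ℕ.+ b)
    run = record
      { before = ¬Q-lo
      ; after  = subst (¬_ ∘ Q ∘ r) (sym (i-m+n≡i+o k (cong suc (ℕ.+-suc a b)))) ¬Q-hi
      ; inside = inside
      }

    k-position : k ≡ lo + + suc (toℕ (fromℕ< (s≤s (ℕ.m≤m+n a b))))
    k-position = sym (trans (cong (λ x → lo + + suc x) (toℕ-fromℕ< _)) (i-m+m≡i k (suc a)))

Adj-sym : (G : BipGraph) → ∀ {u v} → Adj G u v → Adj G v u
Adj-sym G {inj₁ _} {inj₂ _} uv = uv
Adj-sym G {inj₂ _} {inj₁ _} uv = uv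

ray-injective : ∀ {G} (r : DoubleRay G) → Injective _≡_ _≡_ (DoubleRay.ray r)
ray-injective r = DoubleRay.injective r _ _

ray-adjacent+ : ∀ {G} (r : DoubleRay G) i n → Adj G (DoubleRay.ray r (i + + n)) (DoubleRay.ray r (i + + suc n))
ray-adjacent+ {G} r i n =
  subst (Adj G (DoubleRay.ray r (i + + n)) ∘ DoubleRay.ray r) (suc[i+n]≡i+[1+n] i n) (DoubleRay.adjacent r _)

Image : {F : Set} → (F → S) → S → Set
Image ι s = ∃ λ w → ι w ≡ s

Σ-Image↔ : {F : Set} {ι : F → S} → Σ S (Image ι) ↔ F
Σ-Image↔ {ι = ι} = mk↔ₛ′ (proj₁ ∘ proj₂) (λ w → ι w , w , refl) (λ _ → refl) λ { (_ , _ , refl) → refl }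

module _ {G H : BipGraph} {ι : V H → V G} (ι-reflects : ∀ u w → Adj G (ι u) (ι w) → Adj H u w)
         (r : DoubleRay G) {lo len} (run : MaximalRun (Image ι) (DoubleRay.ray r) lo len) where

  open MaximalRun run

  private
    ray : ℤ → V G
    ray = DoubleRay.ray r

    vtx : Fin (suc len) → V H
    vtx = proj₁ ∘ inside

    position : ∀ t → ι (vtx t) ≡ ray (lo + + suc (toℕ t))
    position = proj₂ ∘ inside

    vtx-injective : ∀ s t → vtx s ≡ vtx t → s ≡ t
    vtx-injective s t eq = toℕ-injective (ℕ.suc-injective (i+m≡i+n⇒m≡n lo (ray-injective r (begin
      ray (lo + + suc (toℕ s)) ≡⟨ sym (position s) ⟩
      ι (vtx s)                ≡⟨ cong ι eq ⟩
      ι (vtx t)                ≡⟨ position t ⟩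
      ray (lo + + suc (toℕ t)) ∎))))

    vtx-adjacent : ∀ t → Adj H (vtx (inject₁ t)) (vtx (suc t))
    vtx-adjacent t =
      ι-reflects _ _ (subst₂ (Adj G) (sym (position (inject₁ t))) (sym (position (suc t))) step)
      where
      step : Adj G (ray (lo + + suc (toℕ (inject₁ t)))) (ray (lo + + suc (suc (toℕ t))))
      step = subst (λ x → Adj G (ray (lo + + suc x)) (ray (lo + + suc (suc (toℕ t)))))
                   (sym (toℕ-inject₁ t)) (ray-adjacent+ r lo (suc (toℕ t)))

  runPath : Path H
  runPath = record { len = len ; vtx = vtx ; injective = vtx-injective ; adjacent = vtx-adjacent }

  runPath-position : ∀ t → ι (Path.vtx runPath t) ≡ DoubleRay.ray r (lo + + suc (toℕ t))
  runPath-position = position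

-- The graph G built from M

≤⇒T-not-<ᵇ : ∀ {i j} → j ≤ i → T (not (i <ᵇ j))
≤⇒T-not-<ᵇ {i} {j} j≤i with i <ᵇ j in i<ᵇj
... | false = tt
... | true  = ℕ.≤⇒≯ j≤i (ℕ.<ᵇ⇒< i j (subst T (sym i<ᵇj) tt))

T-not-<ᵇ⇒≤ : ∀ {i j} → T (not (i <ᵇ j)) → j ≤ i
T-not-<ᵇ⇒≤ {i} {j} _ with i <ᵇ j in i<ᵇj
... | false = ℕ.≮⇒≥ (λ i<j → subst T i<ᵇj (ℕ.<⇒<ᵇ i<j))

Bool-≢⇒≡⊎≡ : ∀ {β β′} → β ≢ β′ → ∀ γ → γ ≡ β ⊎ γ ≡ β′
Bool-≢⇒≡⊎≡ {β} β≢β′ γ with γ ≟ β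
... | yes γ≡β = inj₁ γ≡β
... | no  γ≢β = inj₂ (trans (¬-not γ≢β) (sym (¬-not (β≢β′ ∘ sym))))

module Ladder (n m : ℕ) (E : Fin n → Fin m → Bool) where

  M : BipGraph
  M = finGraph n m E

  A′ : Set
  A′ = Fin n ⊎ ℕ

  B′ : Set
  B′ = (Fin m ⊎ Bool) ⊎ ℕ

  gate : Bool → B′
  gate = inj₁ ∘ inj₂

  E′ : A′ → B′ → Bool
  E′ _        (inj₁ (inj₂ _)) = true
  E′ (inj₁ x) (inj₁ (inj₁ y)) = E x y
  E′ (inj₂ _) (inj₁ (inj₁ _)) = false
  E′ (inj₁ _) (inj₂ _)        = false
  E′ (inj₂ i) (inj₂ j)        = not (i <ᵇ j)

  G : BipGraph
  G = record { A = A′ ; B = B′ ; E = E′ }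

  AtLeastTwo-M? : (X : Fin n → Bool) → Dec (AtLeastTwo M X)
  AtLeastTwo-M? X = Fin.any? λ x → Fin.any? λ y → ¬? (x Fin.≟ y) ×-dec T? (X x) ×-dec T? (X y)

  gate-∈N² : ∀ {X} → AtLeastTwo G X → ∀ β → InN² G X (gate β)
  gate-∈N² (x , y , x≢y , Xx , Xy) β = x , y , x≢y , Xx , Xy , tt , tt

  -- The vertex of X ∩ ℕ with r + 1 smaller elements in X shares the ladder vertex r
  -- with the one with r smaller elements, both being ≥ r; the least one uses a gate.
  rankWitness : ℕ → B′
  rankWitness zero    = gate true
  rankWitness (suc r) = inj₂ r

  rankWitness-injective : Injective _≡_ _≡_ rankWitness
  rankWitness-injective {zero}  {zero}  _    = refl
  rankWitness-injective {suc _} {suc _} refl = refl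
  rankWitness-injective {zero}  {suc _} ()
  rankWitness-injective {suc _} {zero}  ()

  rankWitness-∈N² : ∀ {X} → AtLeastTwo G X → ∀ {i} → T (X (inj₂ i)) →
                    InN² G X (rankWitness (count (X ∘ inj₂) i))
  rankWitness-∈N² {X} X₂ {i} Xi with count (X ∘ inj₂) i in rank-i
  ... | zero  = gate-∈N² X₂ true
  ... | suc r =
    let p , p<i , Xp , rank-p = count≡suc⇒∃ (X ∘ inj₂) rank-i
        r≤p = subst (_≤ p) rank-p (count-≤ (X ∘ inj₂) p)
    in inj₂ p , inj₂ i , ℕ.<⇒≢ p<i ∘ inj₂-injective , Xp , Xi ,
       ≤⇒T-not-<ᵇ r≤p , ≤⇒T-not-<ᵇ (ℕ.≤-trans r≤p (ℕ.<⇒≤ p<i))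

  MPartMatching : (A′ → Bool) → Set
  MPartMatching X =
    Σ[ f ∈ (Elems M (X ∘ inj₁) → B′) ]
      (∀ x → InN² G X (f x)) × (∀ x y → f x ≡ f y → proj₁ x ≡ proj₁ y) × (∀ x r → f x ≢ rankWitness r)

  MPartMatching-from-M : ∀ {X} → N²Large M (X ∘ inj₁) → MPartMatching X
  MPartMatching-from-M {X} (g , g-N² , g-injective) =
    inj₁ ∘ inj₁ ∘ g , f-N² , (λ x y → g-injective x y ∘ inj₁-injective ∘ inj₁-injective) , λ { _ zero () ; _ (suc _) () }
    where
    f-N² : ∀ x → InN² G X (inj₁ (inj₁ (g x)))
    f-N² x = let a , b , a≢b , Xa , Xb , Ea , Eb = g-N² x in inj₁ a , inj₁ b , a≢b ∘ inj₁-injective , Xa , Xb , Ea , Eb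

  MPartMatching-gate : ∀ {X} → AtLeastTwo G X → ¬ AtLeastTwo M (X ∘ inj₁) → MPartMatching X
  MPartMatching-gate {X} X₂ ¬XM₂ = (λ _ → gate false) , (λ _ → gate-∈N² X₂ false) , unique , λ { _ zero () ; _ (suc _) () }
    where
    unique : ∀ (x y : Elems M (X ∘ inj₁)) → gate false ≡ gate false → proj₁ x ≡ proj₁ y
    unique (x , Xx) (y , Xy) _ with x Fin.≟ y
    ... | yes x≡y = x≡y
    ... | no  x≢y = contradiction (x , y , x≢y , Xx , Xy) ¬XM₂

  extend-MPartMatching : ∀ {X} → AtLeastTwo G X → MPartMatching X → N²Large G X
  extend-MPartMatching {X} X₂ (f , f-N² , f-injective , f≢rankWitness) = h , h-N² , h-injective
    where
    h : Elems G X → B′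
    h (inj₁ x , Xx) = f (x , Xx)
    h (inj₂ i , _)  = rankWitness (count (X ∘ inj₂) i)

    h-N² : ∀ x → InN² G X (h x)
    h-N² (inj₁ x , Xx) = f-N² (x , Xx)
    h-N² (inj₂ i , Xi) = rankWitness-∈N² X₂ Xi

    h-injective : ∀ x y → h x ≡ h y → proj₁ x ≡ proj₁ y
    h-injective (inj₁ x , Xx) (inj₁ y , Xy) eq = cong inj₁ (f-injective (x , Xx) (y , Xy) eq)
    h-injective (inj₁ x , Xx) (inj₂ _ , _)  eq = contradiction eq (f≢rankWitness (x , Xx) _)
    h-injective (inj₂ _ , _)  (inj₁ y , Xy) eq = contradiction (sym eq) (f≢rankWitness (y , Xy) _)
    h-injective (inj₂ i , Xi) (inj₂ j , Xj) eq =
      cong inj₂ (count-injective (X ∘ inj₂) Xi Xj (rankWitness-injective eq))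

  dHp-G : dHp M → dHp G
  dHp-G dHp-M = (inj₂ 0 , inj₂ 1 , λ ()) , λ X X₂ → extend-MPartMatching X₂ (M-part X X₂)
    where
    M-part : ∀ X → AtLeastTwo G X → MPartMatching X
    M-part X X₂ with AtLeastTwo-M? (X ∘ inj₁)
    ... | yes XM₂ = MPartMatching-from-M (proj₂ dHp-M _ XM₂)
    ... | no ¬XM₂ = MPartMatching-gate X₂ ¬XM₂

  Infinite-A′ : Infinite A′
  Infinite-A′ = ℕ↣⇒Infinite inj₂ inj₂-injective

  Infinite-B′ : Infinite B′
  Infinite-B′ = ℕ↣⇒Infinite inj₂ inj₂-injective

  Finite-NbA : ∀ a → Finite (NbA G a)
  Finite-NbA (inj₁ _) = Finite-Σ⊎ℕ-bounded {k = 0} (Finite-⊎ Finite-Fin Finite-Bool) _ λ ()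
  Finite-NbA (inj₂ i) = Finite-Σ⊎ℕ-bounded {k = suc i} (Finite-⊎ Finite-Fin Finite-Bool) _ (s≤s ∘ T-not-<ᵇ⇒≤)

  FiniteOrCofiniteNb-G : ∀ v → FiniteOrCofiniteNb G v
  FiniteOrCofiniteNb-G (inj₁ (inj₁ _)) = inj₁ (Finite-Σ⊎ℕ-bounded {k = 0} Finite-Fin _ λ ())
  FiniteOrCofiniteNb-G (inj₁ (inj₂ _)) =
    inj₂ ((λ _ → false) , Finite-Σ⊎ℕ-bounded {k = 0} Finite-Fin _ (λ ()) , λ _ → mk⇔ id id)
  FiniteOrCofiniteNb-G (inj₂ j) =
    inj₂ (below-j , Finite-Σ⊎ℕ-bounded Finite-Fin _ (ℕ.<ᵇ⇒< _ j) , λ { (inj₁ _) → mk⇔ id id ; (inj₂ _) → mk⇔ id id })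
    where
    below-j : A′ → Bool
    below-j (inj₁ _) = true
    below-j (inj₂ i) = i <ᵇ j

  embed : V M → V G
  embed (inj₁ x) = inj₁ (inj₁ x)
  embed (inj₂ y) = inj₂ (inj₁ (inj₁ y))

  embed-injective : Injective _≡_ _≡_ embed
  embed-injective {inj₁ _} {inj₁ _} refl = refl
  embed-injective {inj₂ _} {inj₂ _} refl = refl
  embed-injective {inj₁ _} {inj₂ _} ()
  embed-injective {inj₂ _} {inj₁ _} ()

  embed-reflects-Adj : ∀ u w → Adj G (embed u) (embed w) → Adj M u w
  embed-reflects-Adj (inj₁ _) (inj₂ _) uw = uw
  embed-reflects-Adj (inj₂ _) (inj₁ _) uw = uw

  InM : V G → Set
  InM = Image embed

  InM? : Decidable InM
  InM? (inj₁ (inj₁ x))        = yes (inj₁ x , refl)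
  InM? (inj₂ (inj₁ (inj₁ y))) = yes (inj₂ y , refl)
  InM? (inj₁ (inj₂ _))        = no λ { (inj₁ _ , ()) ; (inj₂ _ , ()) }
  InM? (inj₂ (inj₁ (inj₂ _))) = no λ { (inj₁ _ , ()) ; (inj₂ _ , ()) }
  InM? (inj₂ (inj₂ _))        = no λ { (inj₁ _ , ()) ; (inj₂ _ , ()) }

  Finite-InM : Finite (Σ (V G) InM)
  Finite-InM = Finite-↔ Σ-Image↔ (Finite-⊎ Finite-Fin Finite-Fin)

  IsGate : V G → Set
  IsGate v = ∃ λ β → v ≡ inj₂ (gate β)

  M-boundary : ∀ w {v} → Adj G (embed w) v → InM v ⊎ IsGate v
  M-boundary (inj₁ _) {inj₂ (inj₁ (inj₁ y))} _ = inj₁ (inj₂ y , refl)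
  M-boundary (inj₁ _) {inj₂ (inj₁ (inj₂ β))} _ = inj₂ (β , refl)
  M-boundary (inj₂ _) {inj₁ (inj₁ x)}        _ = inj₁ (inj₁ x , refl)

  exit-is-gate : ∀ {u v} → InM u → Adj G u v → ¬ InM v → IsGate v
  exit-is-gate (w , refl) uv ¬InM-v with M-boundary w uv
  ... | inj₁ InM-v  = contradiction InM-v ¬InM-v
  ... | inj₂ gate-v = gate-v

  module _ (r : DoubleRay G) {lo len} (run : MaximalRun InM (DoubleRay.ray r) lo len) where

    private
      ray : ℤ → V G
      ray = DoubleRay.ray r
      hi : ℤ
      hi = lo + + suc (suc len)
    open MaximalRun run

    run-ends-are-gates : IsGate (ray lo) × IsGate (ray hi)
    run-ends-are-gates = exit-is-gate (inside zero) (Adj-sym G {ray lo} enter) before ,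
                         exit-is-gate (inside (fromℕ len)) leave after
      where
      enter : Adj G (ray lo) (ray (lo + + 1))
      enter = subst (λ x → Adj G (ray x) (ray (lo + + 1))) (ℤ.+-identityʳ lo) (ray-adjacent+ r lo 0)
      leave : Adj G (ray (lo + + suc (toℕ (fromℕ len)))) (ray hi)
      leave = subst (λ x → Adj G (ray (lo + + suc x)) (ray hi)) (sym (toℕ-fromℕ len)) (ray-adjacent+ r lo (suc len))

    -- The two ends carry distinct gates, and there are only two gates.
    gates-at-run-ends : ∀ {v} → IsGate v → v ≡ ray lo ⊎ v ≡ ray hi
    gates-at-run-ends (γ , refl) with run-ends-are-gates
    ... | (β , lo-gate) , (β′ , hi-gate) = Sum.map (at lo-gate) (at hi-gate) (Bool-≢⇒≡⊎≡ β≢β′ γ)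
      where
      at : ∀ {p δ} → ray p ≡ inj₂ (gate δ) → γ ≡ δ → inj₂ (gate γ) ≡ ray p
      at p-gate γ≡δ = trans (cong (inj₂ ∘ gate) γ≡δ) (sym p-gate)
      β≢β′ : β ≢ β′
      β≢β′ β≡β′ = i+[1+n]≢i lo _ (ray-injective r (trans hi-gate (trans (cong (inj₂ ∘ gate) (sym β≡β′)) (sym lo-gate))))

    gate-position : ∀ {p} → IsGate (ray p) → p ≡ lo ⊎ p ≡ hi
    gate-position = Sum.map (ray-injective r) (ray-injective r) ∘ gates-at-run-ends

  InM-within-run : (r : DoubleRay G) → ∀ {lo len} → MaximalRun InM (DoubleRay.ray r) lo len →
                   ∀ {k} → InM (DoubleRay.ray r k) → Σ[ t ∈ Fin (suc len) ] k ≡ lo + + suc (toℕ t)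
  InM-within-run r run InM-k with maximalRun-around InM? Finite-InM (DoubleRay.ray r) (ray-injective r) InM-k
  ... | _ , _ , run′ , t , k≡ with run-ends-are-gates r run′
  ... | lo′-gate , hi′-gate with ends-unique (gate-position r run lo′-gate) (gate-position r run hi′-gate)
  ... | refl , refl = t , k≡

  covering-path : DoubleRayACover G → Fin n → Σ (Path M) (CoversA M)
  covering-path (I , R , disjoint , covers) x₀ with covers (inj₁ x₀)
  ... | i , k , k↦x₀ with maximalRun-around InM? Finite-InM (DoubleRay.ray (R i)) (ray-injective (R i)) (inj₁ x₀ , sym k↦x₀)
  ... | _ , _ , run , _ = runPath embed-reflects-Adj (R i) run , covered run
    where
    ray : I → ℤ → V G
    ray i = DoubleRay.ray (R i)

    ray-through-M-unique : ∀ {i lo len} → MaximalRun InM (ray i) lo len → ∀ {i′ k′} → InM (ray i′ k′) → i′ ≡ i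
    ray-through-M-unique {i} run {i′} InM-k′
      with maximalRun-around InM? Finite-InM (ray i′) (ray-injective (R i′)) InM-k′
    ... | lo′ , _ , run′ , _ =
      [ disjoint i′ i lo′ _ , disjoint i′ i lo′ _ ] (gates-at-run-ends (R i) run (proj₁ (run-ends-are-gates (R i′) run′)))

    covered : ∀ {i lo len} (run : MaximalRun InM (ray i) lo len) → CoversA M (runPath embed-reflects-Adj (R i) run)
    covered {i} {lo} run x with covers (inj₁ x)
    ... | i′ , k′ , k′↦x =
      let t , k′≡ = InM-within-run (R i) run (inj₁ x , sym on-ray-i)
      in t , embed-injective (begin
        embed (Path.vtx (runPath embed-reflects-Adj (R i) run) t) ≡⟨ runPath-position embed-reflects-Adj (R i) run t ⟩
        ray i (lo + + suc (toℕ t))                                 ≡⟨ cong (ray i) (sym k′≡) ⟩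
        ray i k′                                                   ≡⟨ on-ray-i ⟩
        embed (inj₁ x)                                             ∎)
      where
      on-ray-i : ray i k′ ≡ embed (inj₁ x)
      on-ray-i = subst (λ j → ray j k′ ≡ embed (inj₁ x)) (ray-through-M-unique run (inj₁ x , sym k′↦x)) k′↦x

theorem2p13 : ((G : BipGraph) → dHp G → Infinite (BipGraph.A G) → Infinite (BipGraph.B G)
      → (∀ a → Finite (NbA G a)) → (∀ v → FiniteOrCofiniteNb G v)
      → DoubleRayACover G)
    → (n m : ℕ) (E : Fin n → Fin m → Bool) → dHp (finGraph n m E)
    → Σ[ P ∈ Path (finGraph n m E) ] CoversA (finGraph n m E) P
theorem2p13 hypothesis n m E dHp-M = covering-path cover x₀
  where
  open Ladder n m E
  cover : DoubleRayACover G
  cover = hypothesis G (dHp-G dHp-M) Infinite-A′ Infinite-B′ Finite-NbA FiniteOrCofiniteNb-G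
  x₀ : Fin n
  x₀ = proj₁ (proj₁ dHp-M)
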